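{- Let $\Delta$ be of type $G_2$ with simple roots $\alpha_1,\alpha_2$. Let $\alpha,\beta\in\Delta$ with $\langle\alpha,\beta^\vee\rangle\le0$, $\alpha\ne-\beta$, $\Pi=(\gamma_1,\dots,\gamma_q)=(\alpha,s_\alpha(\beta),s_\alpha s_\beta(\alpha),\dots,s_\beta(\alpha),\beta)$, $\Pi'=(\gamma_q,\dots,\gamma_1)$, $v\in W$, $\mathbf p\in\mathcal P(v,\Pi)$. Consider the cases (E1) $\Pi=(\pm(3\alpha_1+2\alpha_2),\pm(2\alpha_1+\alpha_2),\pm(3\alpha_1+\alpha_2),\pm\alpha_1,\mp\alpha_2,\mp(\alpha_1+\alpha_2))$, $v=s_1s_2s_1$, $\mathrm{end}(\mathbf p)=s_1s_2$, $\mathrm{wt}(\mathbf p)=\alpha_1^\vee+\alpha_2^\vee$; (E2) $\Pi=(\pm(\alpha_1+\alpha_2),\pm\alpha_2,\mp\alpha_1,\mp(3\alpha_1+\alpha_2),\mp(2\alpha_1+\alpha_2),\mp(3\alpha_1+2\alpha_2))$, $v=s_1s_2s_1$, $\mathrm{end}(\mathbf p)=s_1s_2$, $\mathrm{wt}(\mathbf p)=\alpha_1^\vee+\alpha_2^\vee$; (E3) $\Pi$ as in (E1), $v=s_2s_1s_2s_1$, $\mathrm{end}(\mathbf p)=s_2s_1s_2$, $\mathrm{wt}(\mathbf p)=\alpha_1^\vee+\alpha_2^\vee$; (E4) $\Pi$ as in (E2), $v=s_2s_1s_2s_1$, $\mathrm{end}(\mathbf p)=s_2s_1s_2$, $\mathrm{wt}(\mathbf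 p)=\alpha_1^\vee+\alpha_2^\vee$. Then: (1) In case (E1) or (E4), there are exactly two paths $\mathbf p_1,\mathbf p_2\in\mathcal P(v,\Pi)\setminus\{\mathbf p\}$ and a unique path $\mathbf q\in\mathcal P(v,\Pi')$ having the same end and wt as $\mathbf p$; moreover there are two paths $\mathbf r_1,\mathbf r_2\in\{\mathbf p,\mathbf p_1,\mathbf p_2\}$ such that, for the remaining $\mathbf r_3\in\{\mathbf p,\mathbf p_1,\mathbf p_2\}\setminus\{\mathbf r_1,\mathbf r_2\}$, $(-1)^{\mathrm{neg}(\mathbf r_1)}=(-1)^{\mathrm{neg}(\mathbf r_2)}=-(-1)^{\mathrm{neg}(\mathbf r_3)}$ and $(-1)^{\mathrm{neg}(\mathbf r_1)}=(-1)^{\mathrm{neg}(\mathbf q)}$. (2) In case (E2) or (E3), there are exactly three paths $\mathbf q_1,\mathbf q_2,\mathbf q_3\in\mathcal P(v,\Pi')$ with the same end and wt as $\mathbf p$, and no $\mathbf r\in\mathcal P(v,\Pi)\setminus\{\mathbf p\}$ has the same end and wt as $\mathbf p$; moreover there are two paths $\mathbf r_1,\mathbf r_2\in\{\mathbf q_1,\mathbf q_2,\mathbf q_3\}$ such that, for the remaining $\mathbf r_3$, $(-1)^{\mathrm{neg}(\mathbf r_1)}=(-1)^{\mathrm{neg}(\mathbf r_2)}=-(-1)^{\mathrm{neg}(\mathbf r_3)}$ and $(-1)^{\mathrm{neg}(\mathbf r_1)}=(-1)^{\mathrm{neg}(\mathbf p)}$.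
   Context: $W$ is the Weyl group (simple reflections $s_1,s_2$, length $\ell$, reflections $s_\gamma$), $\rho=\frac12\sum_{\gamma\in\Delta^+}\gamma$, $|\gamma|=\pm\gamma\in\Delta^+$. In $\Pi$ the $k$-th entry is obtained by applying $k-1$ alternating reflections $s_\alpha s_\beta\cdots$ (starting with $s_\alpha$) to $\alpha$ ($k$ odd) or $\beta$ ($k$ even), with $q$ such that the last entry is $\beta$. $\mathrm{QBG}(W)$: vertices $W$, edges $x\xrightarrow{\gamma}xs_\gamma$ ($\gamma\in\Delta^+$) iff $\ell(xs_\gamma)=\ell(x)+1$ (Bruhat) or $\ell(xs_\gamma)=\ell(x)-2\langle\rho,\gamma^\vee\rangle+1$ (quantum). $\mathcal P(v,\Pi)$ is the set of index sequences $1\le j_1<\dots<j_p\le q$ such that $v\xrightarrow{|\gamma_{j_1}|}\cdots\xrightarrow{|\gamma_{j_p}|}w_p$ is a directed path in $\mathrm{QBG}(W)$; $\mathrm{end}(\mathbf p)=w_p$, $\mathrm{wt}(\mathbf p)$ is the sum of $|\gamma_{j_k}|^\vee$ over quantum edges, $\mathrm{neg}(\mathbf p)=\#\{k:\gamma_{j_k}\in-\Delta^+\}$. -}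

module Defs where

open import Data.Bool using (Bool; true; false; if_then_else_; _∧_; _∨_; not)
open import Data.Nat as ℕ using (ℕ; zero; suc)
open import Data.Integer as ℤ using (ℤ; +_; -_; _+_; _-_; _*_; 0ℤ; 1ℤ)
open import Data.Product using (_×_; _,_; proj₁; proj₂)
open import Data.Sum using (_⊎_)
open import Data.Unit using (⊤)
open import Data.List using (List; []; _∷_; map; length; lookup; foldr; reverse)
open import Data.List.Membership.Propositional using (_∈_)
open import Data.List.Relation.Unary.Linked using (Linked)
open import Data.Fin as Fin using (Fin)
open import Relation.Binary.PropositionalEquality using (_≡_)
open import Relation.Nullary using (does)

-- Elements of the root lattice are written in coordinates w.r.t. the
-- simple roots: (c₁ , c₂) means c₁ α₁ + c₂ α₂.  α₁ is short, α₂ long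
-- (forced by the list of roots occurring in the statement).
-- Coweights/coroots are written in coordinates w.r.t. α₁^∨, α₂^∨.

Vec2 : Set
Vec2 = ℤ × ℤ

_≟v_ : (x y : Vec2) → Bool
(a , b) ≟v (c , d) = does (a ℤ.≟ c) ∧ does (b ℤ.≟ d)

negV : Vec2 → Vec2
negV (a , b) = (- a , - b)

_+v_ : Vec2 → Vec2 → Vec2
(a , b) +v (c , d) = (a + c , b + d)

_·v_ : ℤ → Vec2 → Vec2
k ·v (a , b) = (k * a , k * b)

ℤ2 ℤ3 : ℤ
ℤ2 = + 2
ℤ3 = + 3

α₁ α₂ : Vec2
α₁ = (1ℤ , 0ℤ)
α₂ = (0ℤ , 1ℤ)

Δ⁺ : List Vec2
Δ⁺ = (1ℤ , 0ℤ) ∷ (0ℤ , 1ℤ) ∷ (1ℤ , 1ℤ) ∷ (ℤ2 , 1ℤ) ∷ (ℤ3 , 1ℤ) ∷ (ℤ3 , ℤ2) ∷ []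

elemB : Vec2 → List Vec2 → Bool
elemB x [] = false
elemB x (y ∷ ys) = (x ≟v y) ∨ elemB x ys

isPos : Vec2 → Bool
isPos γ = elemB γ Δ⁺

isNeg : Vec2 → Bool
isNeg γ = isPos (negV γ)

IsRoot : Vec2 → Set
IsRoot γ = γ ∈ Δ⁺ ⊎ negV γ ∈ Δ⁺

∣_∣r : Vec2 → Vec2
∣ γ ∣r = if isPos γ then γ else negV γ

-- Invariant form normalised by (α₁,α₁)=2, (α₁,α₂)=-3, (α₂,α₂)=6.
-- For γ = c₁α₁ + c₂α₂ one has γ = c₁ α₁^∨ + 3 c₂ α₂^∨, and
-- γ^∨ = 2γ/(γ,γ): so γ^∨ = (c₁ , 3c₂) for γ short ((γ,γ)=2) and
-- γ^∨ = (c₁/3 , c₂) for γ long ((γ,γ)=6).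
normSq : Vec2 → ℤ
normSq (a , b) = ℤ2 * a * a - + 6 * a * b + + 6 * b * b

coroot : Vec2 → Vec2
coroot (a , b) =
  if does (normSq (a , b) ℤ.≟ ℤ2) then (a , ℤ3 * b) else (a ℤ./ ℤ3 , b)

-- ⟨λ , μ⟩ for λ in the root lattice and μ (coroot coordinates);
-- ⟨α₁,α₁^∨⟩ = 2, ⟨α₁,α₂^∨⟩ = -1, ⟨α₂,α₁^∨⟩ = -3, ⟨α₂,α₂^∨⟩ = 2.
⟨_,_⟩ : Vec2 → Vec2 → ℤ
⟨ (l₁ , l₂) , (d₁ , d₂) ⟩ = l₁ * (ℤ2 * d₁ - d₂) + l₂ * (ℤ2 * d₂ - ℤ3 * d₁)

reflect : Vec2 → Vec2 → Vec2
reflect γ λ' = λ' +v (negV (⟨ λ' , coroot γ ⟩ ·v γ))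

-- Weyl group W, realised faithfully as linear automorphisms of the root
-- lattice: w is recorded by the images w(α₁) = col₁ and w(α₂) = col₂.

record W : Set where
  constructor mkW
  field
    col₁ : Vec2
    col₂ : Vec2
open W public

act : W → Vec2 → Vec2
act w (l₁ , l₂) = (l₁ ·v col₁ w) +v (l₂ ·v col₂ w)

_∘W_ : W → W → W
x ∘W y = mkW (act x (col₁ y)) (act x (col₂ y))

sR : Vec2 → W
sR γ = mkW (reflect γ α₁) (reflect γ α₂)

e s₁ s₂ : W
e = mkW α₁ α₂
s₁ = sR α₁
s₂ = sR α₂

countB : {A : Set} → (A → Bool) → List A → ℕ
countB f [] = 0
countB f (x ∷ xs) = if f x then suc (countB f xs) else countB f xs

ℓ : W → ℕ
ℓ w = countB (λ γ → isNeg (act w γ)) Δ⁺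

-- 2ρ = Σ_{γ∈Δ⁺} γ, so 2⟨ρ,γ^∨⟩ = ⟨2ρ,γ^∨⟩
twoρ : Vec2
twoρ = foldr _+v_ (0ℤ , 0ℤ) Δ⁺

BruhatEdge : W → Vec2 → Set
BruhatEdge x γ = ℓ (x ∘W sR γ) ≡ suc (ℓ x)

QuantumEdge : W → Vec2 → Set
QuantumEdge x γ = + ℓ (x ∘W sR γ) ≡ + ℓ x - ⟨ twoρ , coroot γ ⟩ + 1ℤ

isQuantum : W → Vec2 → Bool
isQuantum x γ = does (+ ℓ (x ∘W sR γ) ℤ.≟ + ℓ x - ⟨ twoρ , coroot γ ⟩ + 1ℤ)

Edge : W → Vec2 → Set
Edge x γ = γ ∈ Δ⁺ × (BruhatEdge x γ ⊎ QuantumEdge x γ)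

IsQBGPath : W → List Vec2 → Set
IsQBGPath x [] = ⊤
IsQBGPath x (γ ∷ γs) = Edge x γ × IsQBGPath (x ∘W sR γ) γs

endL : W → List Vec2 → W
endL x [] = x
endL x (γ ∷ γs) = endL (x ∘W sR γ) γs

wtL : W → List Vec2 → Vec2
wtL x [] = (0ℤ , 0ℤ)
wtL x (γ ∷ γs) =
  (if isQuantum x γ then coroot γ else (0ℤ , 0ℤ)) +v wtL (x ∘W sR γ) γs


altApply : Vec2 → Vec2 → ℕ → Vec2 → Vec2
altApply α β zero λ' = λ'
altApply α β (suc k) λ' = altApply α β k (reflect (letterK k) λ')
  where
  letterK : ℕ → Vec2
  letterK zero = α
  letterK (suc zero) = β
  letterK (suc (suc j)) = letterK j

-- k-th entry (k ≥ 1, here indexed by k-1 = n)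
entry : Vec2 → Vec2 → ℕ → Vec2
entry α β n = altApply α β n (base n)
  where
  base : ℕ → Vec2
  base zero = α
  base (suc zero) = β
  base (suc (suc j)) = base j

-- entries 1 … (m + 1) as long as β has not been reached; q is the least
-- k with k-th entry equal to β (searched with fuel 12 ≥ 2·|Δ⁺|)
piFrom : Vec2 → Vec2 → ℕ → ℕ → List Vec2
piFrom α β n zero = []
piFrom α β n (suc fuel) =
  entry α β n ∷ (if entry α β n ≟v β then [] else piFrom α β (suc n) fuel)

PiSeq : Vec2 → Vec2 → List Vec2
PiSeq α β = piFrom α β 0 12

IdxSeq : List Vec2 → Set
IdxSeq Γ = List (Fin (length Γ))

labels : (Γ : List Vec2) → IdxSeq Γ → List Vec2
labels Γ js = map (λ j → ∣ lookup Γ j ∣r) js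

InP : W → (Γ : List Vec2) → IdxSeq Γ → Set
InP v Γ js = Linked Fin._<_ js × IsQBGPath v (labels Γ js)

end : W → (Γ : List Vec2) → IdxSeq Γ → W
end v Γ js = endL v (labels Γ js)

wt : W → (Γ : List Vec2) → IdxSeq Γ → Vec2
wt v Γ js = wtL v (labels Γ js)

neg : (Γ : List Vec2) → IdxSeq Γ → ℕ
neg Γ js = countB (λ j → isNeg (lookup Γ j)) js

sgn : (Γ : List Vec2) → IdxSeq Γ → ℤ
sgn Γ js = (- 1ℤ) ℤ.^ neg Γ js

SameEW : W → (Γ Γ' : List Vec2) → IdxSeq Γ → IdxSeq Γ' → Set
SameEW v Γ Γ' r p = end v Γ r ≡ end v Γ' p × wt v Γ r ≡ wt v Γ' p

-- The explicit λ-chains of cases (E1)/(E3) and (E2)/(E4), upper signs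

ΠE1 : List Vec2
ΠE1 = (ℤ3 , ℤ2) ∷ (ℤ2 , 1ℤ) ∷ (ℤ3 , 1ℤ) ∷ (1ℤ , 0ℤ) ∷ negV (0ℤ , 1ℤ) ∷ negV (1ℤ , 1ℤ) ∷ []

ΠE2 : List Vec2
ΠE2 = (1ℤ , 1ℤ) ∷ (0ℤ , 1ℤ) ∷ negV (1ℤ , 0ℤ) ∷ negV (ℤ3 , 1ℤ) ∷ negV (ℤ2 , 1ℤ) ∷ negV (ℤ3 , ℤ2) ∷ []

PiIs : List Vec2 → List Vec2 → Set
PiIs Π L = Π ≡ L ⊎ Π ≡ map negV L

α₁∨+α₂∨ : Vec2
α₁∨+α₂∨ = (1ℤ , 1ℤ)

-- A path in 𝒫(v,Π) is an increasing sequence of indices into the six entries of Π, so the paths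
-- with prescribed end and wt, the fibre of (end, wt), are found by filtering the 64 increasing
-- sequences with a decision procedure.  Evaluating this fibre in each of the eight cases (four
-- cases, two signs of Π) gives three paths in 𝒫(v,Π) and one in 𝒫(v,Π') in (E1), (E4), and
-- one and three in (E2), (E3), with the signs as claimed; all else is bookkeeping with lists of
-- length three.  Since Π'_E1 = −Π_E2, the paths found for (E1) in Π are those for (E2) in Π',
-- and likewise for (E4) and (E3).
module Submission where

open import Defs
open import Data.Nat as ℕ using (ℕ; zero; suc; s<s⁻¹)
open import Data.Integer as ℤ using (ℤ; -_; _≤_; 0ℤ)
open import Data.Fin as Fin using (Fin; zero; suc)
open import Data.Fin.Properties using (suc-injective)
open import Data.Product using (_×_; _,_; ∃-syntax; ∃₂; proj₁; proj₂)
open import Data.Product.Properties using (≡-dec)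
open import Data.Sum using (_⊎_; inj₁; inj₂; map₂)
open import Data.Unit using (tt)
open import Data.List using (List; []; _∷_; _++_; map; length; filter; reverse)
open import Data.List.Properties using (map-injective; ∷-injectiveʳ)
open import Data.List.Membership.Propositional using (_∈_)
open import Data.List.Membership.Propositional.Properties
  using (∈-map⁺; ∈-map⁻; ∈-++⁺ˡ; ∈-++⁺ʳ; ∈-filter⁺; ∈-filter⁻)
import Data.List.Membership.DecPropositional as DecMembership
open import Data.List.Relation.Unary.All using ([]; _∷_)
open import Data.List.Relation.Unary.AllPairs using ([]; _∷_)
open import Data.List.Relation.Unary.Any as Any using (here; there; toSum)
open import Data.List.Relation.Unary.Any.Properties using (singleton⁻)
open import Data.List.Relation.Unary.Linked as Linked using (Linked; []; _∷_)
import Data.List.Relation.Unary.Linked.Properties as Linked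
open import Data.List.Relation.Unary.Unique.Propositional using (Unique)
import Data.List.Relation.Unary.Unique.Propositional.Properties as Unique
open import Data.List.Relation.Binary.Permutation.Propositional
  using (_↭_; ↭-refl; ↭-prep; ↭-swap; ↭-sym; ↭-trans)
open import Data.List.Relation.Binary.Permutation.Propositional.Properties using (∈-resp-↭)
open import Function using (_∘_)
open import Relation.Binary.Definitions using (DecidableEquality)
open import Relation.Binary.PropositionalEquality
open import Relation.Nullary using (Dec; yes; ¬_)
open import Relation.Nullary.Decidable using (_×-dec_; _⊎-dec_; map′)

zero∷map-suc : ∀ {n} → List (Fin n) → List (Fin (suc n))
zero∷map-suc r = zero ∷ map Fin.suc r

ascendingLists : (n : ℕ) → List (List (Fin n))
ascendingLists zero = [] ∷ []
ascendingLists (suc n) = map (map Fin.suc) (ascendingLists n) ++ map zero∷map-suc (ascendingLists n)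

linked-tail≡map-suc : ∀ {n} {x : Fin (suc n)} xs → Linked Fin._<_ (x ∷ xs) →
                      ∃[ ys ] xs ≡ map Fin.suc ys
linked-tail≡map-suc [] _ = [] , refl
linked-tail≡map-suc (zero ∷ xs) (() ∷ _)
linked-tail≡map-suc (suc y ∷ xs) (_ ∷ l) with linked-tail≡map-suc xs l
... | ys , refl = y ∷ ys , refl

linked-map-suc⁻ : ∀ {n} {ys : List (Fin n)} →
                  Linked Fin._<_ (map Fin.suc ys) → Linked Fin._<_ ys
linked-map-suc⁻ l = Linked.map s<s⁻¹ (Linked.map⁻ l)

ascendingLists-complete : ∀ {n} (r : List (Fin n)) → Linked Fin._<_ r → r ∈ ascendingLists n
ascendingLists-complete {zero} [] _ = here refl
ascendingLists-complete {suc n} [] _ =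
  ∈-++⁺ˡ (∈-map⁺ (map Fin.suc) (ascendingLists-complete [] []))
ascendingLists-complete {suc n} (zero ∷ xs) l with linked-tail≡map-suc xs l
... | ys , refl =
  ∈-++⁺ʳ (map (map Fin.suc) (ascendingLists n))
         (∈-map⁺ zero∷map-suc (ascendingLists-complete ys (linked-map-suc⁻ (Linked.tail l))))
ascendingLists-complete {suc n} (suc x ∷ xs) l with linked-tail≡map-suc xs l
... | ys , refl =
  ∈-++⁺ˡ (∈-map⁺ (map Fin.suc) (ascendingLists-complete (x ∷ ys) (linked-map-suc⁻ l)))

map-suc≢zero∷ : ∀ {n} (xs : List (Fin n)) ys → map Fin.suc xs ≢ zero ∷ ys
map-suc≢zero∷ [] _ ()
map-suc≢zero∷ (_ ∷ _) _ ()

ascendingLists-unique : ∀ n → Unique (ascendingLists n)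
ascendingLists-unique zero = [] ∷ []
ascendingLists-unique (suc n) =
  Unique.++⁺ (Unique.map⁺ map-suc-injective (ascendingLists-unique n))
             (Unique.map⁺ (map-suc-injective ∘ ∷-injectiveʳ) (ascendingLists-unique n))
             disjoint
  where
  map-suc-injective : ∀ {xs ys : List (Fin n)} → map Fin.suc xs ≡ map Fin.suc ys → xs ≡ ys
  map-suc-injective = map-injective suc-injective
  disjoint : ∀ {r} → ¬ (r ∈ map (map Fin.suc) (ascendingLists n)
                         × r ∈ map zero∷map-suc (ascendingLists n))
  disjoint (r∈ˡ , r∈ʳ) with ∈-map⁻ (map Fin.suc) r∈ˡ | ∈-map⁻ zero∷map-suc r∈ʳ
  ... | xs , _ , r≡ˡ | ys , _ , r≡ʳ = map-suc≢zero∷ xs (map Fin.suc ys) (trans (sym r≡ˡ) r≡ʳ)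

_≟V_ : DecidableEquality Vec2
_≟V_ = ≡-dec ℤ._≟_ ℤ._≟_

_≟W_ : DecidableEquality W
mkW a b ≟W mkW c d =
  map′ (λ { (refl , refl) → refl }) (λ { refl → refl , refl }) (a ≟V c ×-dec b ≟V d)

edge? : ∀ x γ → Dec (Edge x γ)
edge? x γ =
  DecMembership._∈?_ _≟V_ γ Δ⁺ ×-dec (ℓ (x ∘W sR γ) ℕ.≟ _ ⊎-dec ℤ.+ ℓ (x ∘W sR γ) ℤ.≟ _)

isQBGPath? : ∀ x γs → Dec (IsQBGPath x γs)
isQBGPath? x [] = yes tt
isQBGPath? x (γ ∷ γs) = edge? x γ ×-dec isQBGPath? (x ∘W sR γ) γs

InP? : ∀ v Γ js → Dec (InP v Γ js)
InP? v Γ js =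
  Linked.linked? (λ i j → Fin.toℕ i ℕ.<? Fin.toℕ j) js ×-dec isQBGPath? v (labels Γ js)

record Reaches (v : W) (Γ : List Vec2) (e : W) (w : Vec2) (p : IdxSeq Γ) : Set where
  constructor reaches
  field
    inP  : InP v Γ p
    end≡ : end v Γ p ≡ e
    wt≡  : wt v Γ p ≡ w

reaches? : ∀ v Γ e w p → Dec (Reaches v Γ e w p)
reaches? v Γ e w p =
  map′ (λ (hp , he , hw) → reaches hp he hw) (λ (reaches hp he hw) → hp , he , hw)
       (InP? v Γ p ×-dec end v Γ p ≟W e ×-dec wt v Γ p ≟V w)

fibre : W → (Γ : List Vec2) → W → Vec2 → List (IdxSeq Γ)
fibre v Γ e w = filter (reaches? v Γ e w) (ascendingLists (length Γ))

∈-fibre⁺ : ∀ {v Γ e w p} → Reaches v Γ e w p → p ∈ fibre v Γ e w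
∈-fibre⁺ {v} {Γ} {e} {w} r =
  ∈-filter⁺ (reaches? v Γ e w) (ascendingLists-complete _ (proj₁ (Reaches.inP r))) r

∈-fibre⁻ : ∀ {v Γ e w p} → p ∈ fibre v Γ e w → Reaches v Γ e w p
∈-fibre⁻ {v} {Γ} {e} {w} p∈ =
  proj₂ (∈-filter⁻ (reaches? v Γ e w) {xs = ascendingLists (length Γ)} p∈)

fibre-unique : ∀ v Γ e w → Unique (fibre v Γ e w)
fibre-unique v Γ e w = Unique.filter⁺ (reaches? v Γ e w) (ascendingLists-unique (length Γ))

reaches⇒sameEW : ∀ {v Γ Γ' e w q p} → Reaches v Γ' e w q → Reaches v Γ e w p → SameEW v Γ' Γ q p
reaches⇒sameEW (reaches _ e₁ w₁) (reaches _ e₂ w₂) = trans e₁ (sym e₂) , trans w₁ (sym w₂)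

sameEW⇒reaches : ∀ {v Γ Γ' e w q p} →
                 InP v Γ' q → SameEW v Γ' Γ q p → Reaches v Γ e w p → Reaches v Γ' e w q
sameEW⇒reaches hq (e₁ , w₁) (reaches _ e₂ w₂) = reaches hq (trans e₁ e₂) (trans w₁ w₂)

module _ {A : Set} where

  ∈-pair⁻ : ∀ {r a b : A} → r ∈ (a ∷ b ∷ []) → r ≡ a ⊎ r ≡ b
  ∈-pair⁻ = map₂ singleton⁻ ∘ toSum

  ∈-triple⁻ : ∀ {r a b c : A} → r ∈ (a ∷ b ∷ c ∷ []) → r ≡ a ⊎ r ≡ b ⊎ r ≡ c
  ∈-triple⁻ = map₂ ∈-pair⁻ ∘ toSum

  Distinct₃ : A → A → A → Set
  Distinct₃ x y z = x ≢ y × x ≢ z × y ≢ z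

  unique⇒distinct₃ : ∀ {x y z : A} → Unique (x ∷ y ∷ z ∷ []) → Distinct₃ x y z
  unique⇒distinct₃ ((x≢y ∷ x≢z ∷ []) ∷ (y≢z ∷ []) ∷ [] ∷ []) = x≢y , x≢z , y≢z

  moveToFront₃ : ∀ {x y z p : A} → Distinct₃ x y z → p ∈ (x ∷ y ∷ z ∷ []) →
                 ∃₂ λ p₁ p₂ → (x ∷ y ∷ z ∷ []) ↭ (p ∷ p₁ ∷ p₂ ∷ []) × Distinct₃ p p₁ p₂
  moveToFront₃ distinct (here refl) = _ , _ , ↭-refl , distinct
  moveToFront₃ (x≢y , x≢z , y≢z) (there (here refl)) =
    _ , _ , ↭-swap _ _ ↭-refl , ≢-sym x≢y , y≢z , x≢z
  moveToFront₃ (x≢y , x≢z , y≢z) (there (there (here refl))) =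
    _ , _ , ↭-trans (↭-prep _ (↭-swap _ _ ↭-refl)) (↭-swap _ _ ↭-refl)
          , ≢-sym x≢z , ≢-sym y≢z , x≢y

  TwoAgainstOne : (A → ℤ) → List A → ℤ → Set
  TwoAgainstOne f xs σ = ∃[ r₁ ] ∃[ r₂ ] ∃[ r₃ ]
    ((r₁ ∷ r₂ ∷ r₃ ∷ []) ↭ xs × f r₁ ≡ f r₂ × f r₂ ≡ - f r₃ × f r₁ ≡ σ)

  TwoAgainstOne-resp-↭ : ∀ {f xs ys σ} → xs ↭ ys → TwoAgainstOne f xs σ → TwoAgainstOne f ys σ
  TwoAgainstOne-resp-↭ xs↭ys (r₁ , r₂ , r₃ , rs↭xs , signs) =
    r₁ , r₂ , r₃ , ↭-trans rs↭xs xs↭ys , signs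

  twoAgainstFirst : ∀ {f x y z σ} → f y ≡ f z → f z ≡ - f x → f y ≡ σ →
                    TwoAgainstOne f (x ∷ y ∷ z ∷ []) σ
  twoAgainstFirst {x = x} {y} {z} fy≡fz fz≡-fx fy≡σ =
    y , z , x , ↭-trans (↭-prep _ (↭-swap _ _ ↭-refl)) (↭-swap _ _ ↭-refl) , fy≡fz , fz≡-fx , fy≡σ

  twoAgainstLast : ∀ {f x y z σ} → f x ≡ f y → f y ≡ - f z → f x ≡ σ →
                   TwoAgainstOne f (x ∷ y ∷ z ∷ []) σ
  twoAgainstLast fx≡fy fy≡-fz fx≡σ = _ , _ , _ , ↭-refl , fx≡fy , fy≡-fz , fx≡σ

ThreeForwardOneBackward : (v : W) (Γ : List Vec2) → IdxSeq Γ → Set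
ThreeForwardOneBackward v Γ p =
  ∃[ p₁ ] ∃[ p₂ ]
    ( InP v Γ p₁ × InP v Γ p₂
    × p₁ ≢ p × p₂ ≢ p × p₁ ≢ p₂
    × SameEW v Γ Γ p₁ p × SameEW v Γ Γ p₂ p
    × ((r : IdxSeq Γ) → InP v Γ r → r ≢ p → SameEW v Γ Γ r p → r ≡ p₁ ⊎ r ≡ p₂)
    × ∃[ q ]
        ( InP v (reverse Γ) q
        × SameEW v (reverse Γ) Γ q p
        × ((q' : IdxSeq (reverse Γ)) → InP v (reverse Γ) q' → SameEW v (reverse Γ) Γ q' p → q' ≡ q)
        × TwoAgainstOne (sgn Γ) (p ∷ p₁ ∷ p₂ ∷ []) (sgn (reverse Γ) q) ) )

OneForwardThreeBackward : (v : W) (Γ : List Vec2) → IdxSeq Γ → Set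
OneForwardThreeBackward v Γ p =
  ∃[ q₁ ] ∃[ q₂ ] ∃[ q₃ ]
    ( InP v (reverse Γ) q₁ × InP v (reverse Γ) q₂ × InP v (reverse Γ) q₃
    × q₁ ≢ q₂ × q₁ ≢ q₃ × q₂ ≢ q₃
    × SameEW v (reverse Γ) Γ q₁ p × SameEW v (reverse Γ) Γ q₂ p × SameEW v (reverse Γ) Γ q₃ p
    × ((q : IdxSeq (reverse Γ)) → InP v (reverse Γ) q → SameEW v (reverse Γ) Γ q p
         → q ≡ q₁ ⊎ q ≡ q₂ ⊎ q ≡ q₃)
    × ((r : IdxSeq Γ) → InP v Γ r → r ≢ p → ¬ SameEW v Γ Γ r p)
    × TwoAgainstOne (sgn (reverse Γ)) (q₁ ∷ q₂ ∷ q₃ ∷ []) (sgn Γ p) )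

module _ {v : W} {Γ : List Vec2} {e : W} {w : Vec2} where

  threeForwardOneBackward :
    ∀ {x y z d p} →
    fibre v Γ e w ≡ x ∷ y ∷ z ∷ [] → fibre v (reverse Γ) e w ≡ d ∷ [] →
    TwoAgainstOne (sgn Γ) (x ∷ y ∷ z ∷ []) (sgn (reverse Γ) d) →
    Reaches v Γ e w p → ThreeForwardOneBackward v Γ p
  threeForwardOneBackward {d = d} {p} forward backward signs reaches-p
    with p₁ , p₂ , xyz↭pp₁p₂ , p≢p₁ , p≢p₂ , p₁≢p₂
           ← moveToFront₃ (unique⇒distinct₃ (subst Unique forward (fibre-unique v Γ e w)))
                          (subst (p ∈_) forward (∈-fibre⁺ reaches-p))
    = p₁ , p₂ , Reaches.inP (reaches-pᵢ p₁∈) , Reaches.inP (reaches-pᵢ p₂∈)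
    , ≢-sym p≢p₁ , ≢-sym p≢p₂ , p₁≢p₂
    , reaches⇒sameEW (reaches-pᵢ p₁∈) reaches-p , reaches⇒sameEW (reaches-pᵢ p₂∈) reaches-p
    , (λ r hr r≢p same →
         ∈-pair⁻ (Any.tail r≢p (∈-pp₁p₂ (sameEW⇒reaches {Γ' = Γ} hr same reaches-p))))
    , d , Reaches.inP reaches-d , reaches⇒sameEW reaches-d reaches-p
    , (λ q hq same → singleton⁻ (subst (q ∈_) backward
                                   (∈-fibre⁺ (sameEW⇒reaches {Γ' = reverse Γ} hq same reaches-p))))
    , TwoAgainstOne-resp-↭ xyz↭pp₁p₂ signs
    where
    p₁∈ : p₁ ∈ (p ∷ p₁ ∷ p₂ ∷ [])
    p₁∈ = there (here refl)
    p₂∈ : p₂ ∈ (p ∷ p₁ ∷ p₂ ∷ [])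
    p₂∈ = there (there (here refl))
    reaches-pᵢ : ∀ {r} → r ∈ (p ∷ p₁ ∷ p₂ ∷ []) → Reaches v Γ e w r
    reaches-pᵢ r∈ = ∈-fibre⁻ (subst (_ ∈_) (sym forward) (∈-resp-↭ (↭-sym xyz↭pp₁p₂) r∈))
    ∈-pp₁p₂ : ∀ {r} → Reaches v Γ e w r → r ∈ (p ∷ p₁ ∷ p₂ ∷ [])
    ∈-pp₁p₂ reaches-r = ∈-resp-↭ xyz↭pp₁p₂ (subst (_ ∈_) forward (∈-fibre⁺ reaches-r))
    reaches-d : Reaches v (reverse Γ) e w d
    reaches-d = ∈-fibre⁻ (subst (d ∈_) (sym backward) (here refl))

  oneForwardThreeBackward :
    ∀ {x y z p₀ p} →
    fibre v Γ e w ≡ p₀ ∷ [] → fibre v (reverse Γ) e w ≡ x ∷ y ∷ z ∷ [] →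
    TwoAgainstOne (sgn (reverse Γ)) (x ∷ y ∷ z ∷ []) (sgn Γ p₀) →
    Reaches v Γ e w p → OneForwardThreeBackward v Γ p
  -- A `with` on the uniqueness proof would make the injectivity analysis of every caller
  -- evaluate `fibre-unique`, which is very slow; the lazy `let` avoids this.
  oneForwardThreeBackward {x} {y} {z} {p₀} {p} forward backward signs reaches-p =
    let x≢y , x≢z , y≢z = unique⇒distinct₃ (subst Unique backward (fibre-unique v (reverse Γ) e w))
    in x , y , z
    , Reaches.inP (reaches-q x∈) , Reaches.inP (reaches-q y∈) , Reaches.inP (reaches-q z∈)
    , x≢y , x≢z , y≢z
    , reaches⇒sameEW (reaches-q x∈) reaches-p
    , reaches⇒sameEW (reaches-q y∈) reaches-p
    , reaches⇒sameEW (reaches-q z∈) reaches-p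
    , (λ q hq same → ∈-triple⁻ (subst (q ∈_) backward
                                  (∈-fibre⁺ (sameEW⇒reaches {Γ' = reverse Γ} hq same reaches-p))))
    , (λ r hr r≢p same →
         r≢p (trans (onlyP₀ (sameEW⇒reaches {Γ' = Γ} hr same reaches-p)) (sym (onlyP₀ reaches-p))))
    , subst (TwoAgainstOne _ _ ∘ sgn Γ) (sym (onlyP₀ reaches-p)) signs
    where
    x∈ : x ∈ (x ∷ y ∷ z ∷ [])
    x∈ = here refl
    y∈ : y ∈ (x ∷ y ∷ z ∷ [])
    y∈ = there (here refl)
    z∈ : z ∈ (x ∷ y ∷ z ∷ [])
    z∈ = there (there (here refl))
    onlyP₀ : ∀ {r} → Reaches v Γ e w r → r ≡ p₀
    onlyP₀ {r} reaches-r = singleton⁻ (subst (r ∈_) forward (∈-fibre⁺ reaches-r))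
    reaches-q : ∀ {q} → q ∈ (x ∷ y ∷ z ∷ []) → Reaches v (reverse Γ) e w q
    reaches-q q∈ = ∈-fibre⁻ (subst (_ ∈_) (sym backward) q∈)

s₁s₂ s₂s₁s₂ s₁s₂s₁ s₂s₁s₂s₁ : W
s₁s₂ = s₁ ∘W s₂
s₂s₁s₂ = s₂ ∘W (s₁ ∘W s₂)
s₁s₂s₁ = s₁ ∘W (s₂ ∘W s₁)
s₂s₁s₂s₁ = s₂ ∘W (s₁ ∘W (s₂ ∘W s₁))

Case : List Vec2 → W → W → (v : W) (Γ : List Vec2) → IdxSeq Γ → Set
Case Π v₀ e₀ v Γ p = PiIs Γ Π × v ≡ v₀ × end v Γ p ≡ e₀ × wt v Γ p ≡ α₁∨+α₂∨

-- The equations `refl` are decided by evaluating the fibres and the signs.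
E1⊎E4⇒threeForwardOneBackward :
  ∀ {v Γ p} → InP v Γ p →
  Case ΠE1 s₁s₂s₁ s₁s₂ v Γ p ⊎ Case ΠE2 s₂s₁s₂s₁ s₂s₁s₂ v Γ p → ThreeForwardOneBackward v Γ p
E1⊎E4⇒threeForwardOneBackward hp (inj₁ (inj₁ refl , refl , he , hw)) =
  threeForwardOneBackward refl refl (twoAgainstFirst refl refl refl) (reaches hp he hw)
E1⊎E4⇒threeForwardOneBackward hp (inj₁ (inj₂ refl , refl , he , hw)) =
  threeForwardOneBackward refl refl (twoAgainstFirst refl refl refl) (reaches hp he hw)
E1⊎E4⇒threeForwardOneBackward hp (inj₂ (inj₁ refl , refl , he , hw)) =
  threeForwardOneBackward refl refl (twoAgainstLast refl refl refl) (reaches hp he hw)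
E1⊎E4⇒threeForwardOneBackward hp (inj₂ (inj₂ refl , refl , he , hw)) =
  threeForwardOneBackward refl refl (twoAgainstLast refl refl refl) (reaches hp he hw)

E2⊎E3⇒oneForwardThreeBackward :
  ∀ {v Γ p} → InP v Γ p →
  Case ΠE2 s₁s₂s₁ s₁s₂ v Γ p ⊎ Case ΠE1 s₂s₁s₂s₁ s₂s₁s₂ v Γ p → OneForwardThreeBackward v Γ p
E2⊎E3⇒oneForwardThreeBackward hp (inj₁ (inj₁ refl , refl , he , hw)) =
  oneForwardThreeBackward refl refl (twoAgainstFirst refl refl refl) (reaches hp he hw)
E2⊎E3⇒oneForwardThreeBackward hp (inj₁ (inj₂ refl , refl , he , hw)) =
  oneForwardThreeBackward refl refl (twoAgainstFirst refl refl refl) (reaches hp he hw)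
E2⊎E3⇒oneForwardThreeBackward hp (inj₂ (inj₁ refl , refl , he , hw)) =
  oneForwardThreeBackward refl refl (twoAgainstLast refl refl refl) (reaches hp he hw)
E2⊎E3⇒oneForwardThreeBackward hp (inj₂ (inj₂ refl , refl , he , hw)) =
  oneForwardThreeBackward refl refl (twoAgainstLast refl refl refl) (reaches hp he hw)

-- The hypotheses on α and β are not used: the case hypotheses already fix Π.
proposition4p8 :
    (α β : Vec2) → IsRoot α → IsRoot β →
    ⟨ α , coroot β ⟩ ≤ 0ℤ → α ≢ negV β →
    (v : W) (p : IdxSeq (PiSeq α β)) → InP v (PiSeq α β) p →
    -- (1) cases (E1) or (E4)
    (  (  (PiIs (PiSeq α β) ΠE1 × v ≡ s₁ ∘W (s₂ ∘W s₁)
            × end v (PiSeq α β) p ≡ s₁ ∘W s₂ × wt v (PiSeq α β) p ≡ α₁∨+α₂∨)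
        ⊎ (PiIs (PiSeq α β) ΠE2 × v ≡ s₂ ∘W (s₁ ∘W (s₂ ∘W s₁))
            × end v (PiSeq α β) p ≡ s₂ ∘W (s₁ ∘W s₂) × wt v (PiSeq α β) p ≡ α₁∨+α₂∨) )
      →
        ∃[ p₁ ] ∃[ p₂ ]
          ( InP v (PiSeq α β) p₁ × InP v (PiSeq α β) p₂
          × p₁ ≢ p × p₂ ≢ p × p₁ ≢ p₂
          × SameEW v (PiSeq α β) (PiSeq α β) p₁ p × SameEW v (PiSeq α β) (PiSeq α β) p₂ p
          × ((r : IdxSeq (PiSeq α β)) → InP v (PiSeq α β) r → r ≢ p
               → SameEW v (PiSeq α β) (PiSeq α β) r p → r ≡ p₁ ⊎ r ≡ p₂)
          × ∃[ q ]
              ( InP v (reverse (PiSeq α β)) q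
              × SameEW v (reverse (PiSeq α β)) (PiSeq α β) q p
              × ((q' : IdxSeq (reverse (PiSeq α β))) → InP v (reverse (PiSeq α β)) q'
                   → SameEW v (reverse (PiSeq α β)) (PiSeq α β) q' p → q' ≡ q)
              × ∃[ r₁ ] ∃[ r₂ ] ∃[ r₃ ]
                  ( (r₁ ∷ r₂ ∷ r₃ ∷ []) ↭ (p ∷ p₁ ∷ p₂ ∷ [])
                  × sgn (PiSeq α β) r₁ ≡ sgn (PiSeq α β) r₂
                  × sgn (PiSeq α β) r₂ ≡ - sgn (PiSeq α β) r₃
                  × sgn (PiSeq α β) r₁ ≡ sgn (reverse (PiSeq α β)) q ) ) ) )
    ×
    -- (2) cases (E2) or (E3)
    (  (  (PiIs (PiSeq α β) ΠE2 × v ≡ s₁ ∘W (s₂ ∘W s₁)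
            × end v (PiSeq α β) p ≡ s₁ ∘W s₂ × wt v (PiSeq α β) p ≡ α₁∨+α₂∨)
        ⊎ (PiIs (PiSeq α β) ΠE1 × v ≡ s₂ ∘W (s₁ ∘W (s₂ ∘W s₁))
            × end v (PiSeq α β) p ≡ s₂ ∘W (s₁ ∘W s₂) × wt v (PiSeq α β) p ≡ α₁∨+α₂∨) )
      →
        ∃[ q₁ ] ∃[ q₂ ] ∃[ q₃ ]
          ( InP v (reverse (PiSeq α β)) q₁ × InP v (reverse (PiSeq α β)) q₂
          × InP v (reverse (PiSeq α β)) q₃
          × q₁ ≢ q₂ × q₁ ≢ q₃ × q₂ ≢ q₃
          × SameEW v (reverse (PiSeq α β)) (PiSeq α β) q₁ p
          × SameEW v (reverse (PiSeq α β)) (PiSeq α β) q₂ p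
          × SameEW v (reverse (PiSeq α β)) (PiSeq α β) q₃ p
          × ((q : IdxSeq (reverse (PiSeq α β))) → InP v (reverse (PiSeq α β)) q
               → SameEW v (reverse (PiSeq α β)) (PiSeq α β) q p
               → q ≡ q₁ ⊎ q ≡ q₂ ⊎ q ≡ q₃)
          × ((r : IdxSeq (PiSeq α β)) → InP v (PiSeq α β) r → r ≢ p
               → ¬ SameEW v (PiSeq α β) (PiSeq α β) r p)
          × ∃[ r₁ ] ∃[ r₂ ] ∃[ r₃ ]
              ( (r₁ ∷ r₂ ∷ r₃ ∷ []) ↭ (q₁ ∷ q₂ ∷ q₃ ∷ [])
              × sgn (reverse (PiSeq α β)) r₁ ≡ sgn (reverse (PiSeq α β)) r₂
              × sgn (reverse (PiSeq α β)) r₂ ≡ - sgn (reverse (PiSeq α β)) r₃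
              × sgn (reverse (PiSeq α β)) r₁ ≡ sgn (PiSeq α β) p ) ) )
proposition4p8 _ _ _ _ _ _ _ _ hp =
  E1⊎E4⇒threeForwardOneBackward hp , E2⊎E3⇒oneForwardThreeBackward hp
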